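{- Let $D_1$ and $D_2$ be tournaments with involution (each involution denoted $x\mapsto x'$), and let $f:U\to W$ be a homomorphism from $D_1[U]$ to $D_2[W]$. Assume there is $u\in U$ with $u'\in U$ and $f(u)=f(u')$, and put $v=f(u)$. Then (a) $f(U)\subseteq\{v,v'\}$; (b) $f$ extends to a homomorphism $f^*:D_1\to D_2$.
   Context: Finite digraph $D=(V,E)$; $x\to y$ means $(x,y)\in E$, $x\sim y$: $x\to y$ or $y\to x$; $x\rightleftarrows y$: both. Reflexive: all loops; improper: $E$ neither symmetric nor antisymmetric. $D[W]$ is the induced subdigraph on nonempty $W$. Homomorphism: vertex map with $x\to y\Rightarrow f(x)\to f(y)$. A digraph with involution is a reflexive improper digraph with an automorphism $x\mapsto x'$ such that $x''=x$; $x\to y\Rightarrow y\to x'$; and $x\ne y$, $x\rightleftarrows y$ imply $y=x'$. A tournament with involution is a digraph with involution in which $x\sim y$ for all vertices $x,y$. -}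

module Defs where

open import Data.Nat using (ℕ)
open import Data.Fin using (Fin)
open import Data.Fin.Subset using (Subset; _∈_)
open import Data.Product using (Σ; ∃; ∃-syntax; _×_; _,_; proj₁)
open import Data.Sum using (_⊎_)
open import Relation.Nullary using (¬_)
open import Relation.Binary.PropositionalEquality using (_≡_; _≢_)

record Digraph : Set₁ where
  field
    n   : ℕ
    _⇒_ : Fin n → Fin n → Set

open Digraph public

V : Digraph → Set
V D = Fin (n D)

_∶_∼_ : (D : Digraph) → V D → V D → Set
D ∶ x ∼ y = _⇒_ D x y ⊎ _⇒_ D y x

_∶_⇄_ : (D : Digraph) → V D → V D → Set
D ∶ x ⇄ y = _⇒_ D x y × _⇒_ D y x

Reflexive : Digraph → Set
Reflexive D = ∀ x → _⇒_ D x x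

Symmetric : Digraph → Set
Symmetric D = ∀ x y → _⇒_ D x y → _⇒_ D y x

Antisymmetric : Digraph → Set
Antisymmetric D = ∀ x y → _⇒_ D x y → _⇒_ D y x → x ≡ y

Improper : Digraph → Set
Improper D = ¬ Symmetric D × ¬ Antisymmetric D

IsAutomorphism : (D : Digraph) → (V D → V D) → Set
IsAutomorphism D σ =
  (Σ (V D → V D) λ τ → ((∀ x → τ (σ x) ≡ x) × (∀ x → σ (τ x) ≡ x)))
  × (∀ x y → _⇒_ D x y → _⇒_ D (σ x) (σ y))
  × (∀ x y → _⇒_ D (σ x) (σ y) → _⇒_ D x y)

IsDigraphWithInvolution : (D : Digraph) → (V D → V D) → Set
IsDigraphWithInvolution D σ =
  Reflexive D × Improper D × IsAutomorphism D σ
  × (∀ x → σ (σ x) ≡ x)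
  × (∀ x y → _⇒_ D x y → _⇒_ D y (σ x))
  × (∀ x y → x ≢ y → D ∶ x ⇄ y → y ≡ σ x)

IsTournamentWithInvolution : (D : Digraph) → (V D → V D) → Set
IsTournamentWithInvolution D σ =
  IsDigraphWithInvolution D σ × (∀ x y → D ∶ x ∼ y)

-- vertices of the induced subdigraph D[U]
Elem : (D : Digraph) → Subset (n D) → Set
Elem D U = Σ (V D) (λ x → x ∈ U)

IsHomInduced : (D₁ D₂ : Digraph) (U : Subset (n D₁)) (W : Subset (n D₂))
  → (Elem D₁ U → Elem D₂ W) → Set
IsHomInduced D₁ D₂ U W f =
  ∀ (x y : Elem D₁ U) → _⇒_ D₁ (proj₁ x) (proj₁ y)
    → _⇒_ D₂ (proj₁ (f x)) (proj₁ (f y))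

IsHom : (D₁ D₂ : Digraph) → (V D₁ → V D₂) → Set
IsHom D₁ D₂ g = ∀ x y → _⇒_ D₁ x y → _⇒_ D₂ (g x) (g y)

-- Let v = f u = f u'. Each x ∈ U is comparable with u; if x → u then also u' → x,
-- and if u → x then also x → u', so either way f x ⇄ v, which forces f x ∈ {v, v'}.
-- The two vertices v, v' span a complete subdigraph of D₂ (v → v' and v' → v),
-- so sending every vertex outside U to v extends f to a homomorphism on all of D₁.
module Submission where

open import Defs
open import Data.Nat using (ℕ)
open import Data.Fin using (Fin; _≟_)
open import Data.Fin.Subset using (Subset; _∈_)
open import Data.Fin.Subset.Properties using (_∈?_)
open import Data.Vec.Properties.WithK using ([]=-irrelevant)
open import Data.Product using (Σ; _×_; _,_; proj₁; proj₂)
open import Data.Sum using (_⊎_; inj₁; inj₂)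
open import Data.Empty using (⊥-elim)
open import Function using (_∘_)
open import Relation.Nullary using (yes; no)
open import Relation.Binary.PropositionalEquality

module _ {A : Set} {n : ℕ} (U : Subset n) (f : Σ (Fin n) (_∈ U) → A) (d : A) where

  extend : Fin n → A
  extend x with x ∈? U
  ... | yes x∈U = f (x , x∈U)
  ... | no  _   = d

  extend-agrees : ∀ x (x∈U : x ∈ U) → extend x ≡ f (x , x∈U)
  extend-agrees x x∈U with x ∈? U
  ... | yes x∈U′ = cong (λ p → f (x , p)) ([]=-irrelevant x∈U′ x∈U)
  ... | no  x∉U  = ⊥-elim (x∉U x∈U)

  extend-preserves : (P : A → Set) → (∀ e → P (f e)) → P d → ∀ x → P (extend x)
  extend-preserves P Pf Pd x with x ∈? U
  ... | yes x∈U = Pf (x , x∈U)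
  ... | no  _   = Pd

module DigraphWithInvolution {D : Digraph} {σ : V D → V D}
    (I : IsDigraphWithInvolution D σ) where

  open Digraph D using () renaming (_⇒_ to _⟶_)

  ⇒-refl : ∀ x → x ⟶ x
  ⇒-refl = proj₁ I

  σ-hom : ∀ {x y} → x ⟶ y → σ x ⟶ σ y
  σ-hom = proj₁ (proj₂ (proj₁ (proj₂ (proj₂ I)))) _ _

  σ-involutive : ∀ x → σ (σ x) ≡ x
  σ-involutive = proj₁ (proj₂ (proj₂ (proj₂ I)))

  ⇒-rotate : ∀ {x y} → x ⟶ y → y ⟶ σ x
  ⇒-rotate = proj₁ (proj₂ (proj₂ (proj₂ (proj₂ I)))) _ _

  ⇄⇒≡σ : ∀ {x y} → x ≢ y → x ⟶ y → y ⟶ x → y ≡ σ x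
  ⇄⇒≡σ x≢y x⇒y y⇒x = proj₂ (proj₂ (proj₂ (proj₂ (proj₂ I)))) _ _ x≢y (x⇒y , y⇒x)

  ⇒-reverse : ∀ {x y} → x ⟶ y → σ y ⟶ x
  ⇒-reverse {x} {y} x⇒y = subst (σ y ⟶_) (σ-involutive x) (⇒-rotate (σ-hom x⇒y))

  ⇒-σ : ∀ x → x ⟶ σ x
  ⇒-σ x = ⇒-rotate (⇒-refl x)

  σ-⇒ : ∀ x → σ x ⟶ x
  σ-⇒ x = ⇒-reverse (⇒-refl x)

  InPair : V D → V D → Set
  InPair v y = y ≡ v ⊎ y ≡ σ v

  ⇄⇒inPair : ∀ {x y} → x ⟶ y → y ⟶ x → InPair x y
  ⇄⇒inPair {x} {y} x⇒y y⇒x with y ≟ x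
  ... | yes y≡x = inj₁ y≡x
  ... | no  y≢x = inj₂ (⇄⇒≡σ (y≢x ∘ sym) x⇒y y⇒x)

  inPair⇒ : ∀ {v a b} → InPair v a → InPair v b → a ⟶ b
  inPair⇒ {v} (inj₁ refl) (inj₁ refl) = ⇒-refl v
  inPair⇒ {v} (inj₁ refl) (inj₂ refl) = ⇒-σ v
  inPair⇒ {v} (inj₂ refl) (inj₁ refl) = σ-⇒ v
  inPair⇒ {v} (inj₂ refl) (inj₂ refl) = ⇒-refl (σ v)

  hom-into-pair : (D₀ : Digraph) (g : V D₀ → V D) (v : V D)
    → (∀ x → InPair v (g x)) → IsHom D₀ D g
  hom-into-pair D₀ g v g∈pair x y _ = inPair⇒ (g∈pair x) (g∈pair y)

module _ {D₁ D₂ : Digraph} {σ₁ : V D₁ → V D₁} {σ₂ : V D₂ → V D₂}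
    (T₁ : IsTournamentWithInvolution D₁ σ₁)
    (I₂ : IsDigraphWithInvolution D₂ σ₂)
    {U : Subset (n D₁)} {W : Subset (n D₂)}
    (f : Elem D₁ U → Elem D₂ W) (f-hom : IsHomInduced D₁ D₂ U W f)
    (u : V D₁) (u∈U : u ∈ U) (u'∈U : σ₁ u ∈ U)
    (f-collapses : proj₁ (f (u , u∈U)) ≡ proj₁ (f (σ₁ u , u'∈U))) where

  open DigraphWithInvolution (proj₁ T₁) using (⇒-rotate; ⇒-reverse)
  open DigraphWithInvolution I₂ using (InPair; ⇄⇒inPair)
  open Digraph D₂ using () renaming (_⇒_ to _⟶_)

  image-inPair : (x : Elem D₁ U) → InPair (proj₁ (f (u , u∈U))) (proj₁ (f x))
  image-inPair x with proj₂ T₁ (proj₁ x) u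
  ... | inj₁ x⇒u = ⇄⇒inPair
          (subst (_⟶ proj₁ (f x)) (sym f-collapses) (f-hom (σ₁ u , u'∈U) x (⇒-reverse x⇒u)))
          (f-hom x (u , u∈U) x⇒u)
  ... | inj₂ u⇒x = ⇄⇒inPair
          (f-hom (u , u∈U) x u⇒x)
          (subst (proj₁ (f x) ⟶_) (sym f-collapses) (f-hom x (σ₁ u , u'∈U) (⇒-rotate u⇒x)))

lemma4p4 : (D₁ D₂ : Digraph) (σ₁ : V D₁ → V D₁) (σ₂ : V D₂ → V D₂)
    → IsTournamentWithInvolution D₁ σ₁
    → IsTournamentWithInvolution D₂ σ₂
    → (U : Subset (n D₁)) (W : Subset (n D₂))
    → (f : Elem D₁ U → Elem D₂ W)
    → IsHomInduced D₁ D₂ U W f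
    → (u : V D₁) (u∈U : u ∈ U) (u'∈U : σ₁ u ∈ U)
    → proj₁ (f (u , u∈U)) ≡ proj₁ (f (σ₁ u , u'∈U))
    → ((x : Elem D₁ U) → (proj₁ (f x) ≡ proj₁ (f (u , u∈U)))
                          ⊎ (proj₁ (f x) ≡ σ₂ (proj₁ (f (u , u∈U)))))
      × (Σ (V D₁ → V D₂) λ g → IsHom D₁ D₂ g
           × ((x : Elem D₁ U) → g (proj₁ x) ≡ proj₁ (f x)))
lemma4p4 D₁ D₂ σ₁ σ₂ T₁ T₂ U W f f-hom u u∈U u'∈U f-collapses =
  f∈pair , g , hom-into-pair D₁ g v g∈pair , λ (x , x∈U) → extend-agrees U f₀ v x x∈U
  where
  open DigraphWithInvolution (proj₁ T₂) using (InPair; hom-into-pair)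
  v : V D₂
  v = proj₁ (f (u , u∈U))
  f₀ : Elem D₁ U → V D₂
  f₀ = proj₁ ∘ f
  f∈pair : (x : Elem D₁ U) → InPair v (f₀ x)
  f∈pair = image-inPair T₁ (proj₁ T₂) f f-hom u u∈U u'∈U f-collapses
  g : V D₁ → V D₂
  g = extend U f₀ v
  g∈pair : ∀ x → InPair v (g x)
  g∈pair = extend-preserves U f₀ v (InPair v) f∈pair (inj₁ refl)
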